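{- Let $g:\mathbb{N}\to\mathbb{C}$ be the Gutman–Ivić–Matula function, i.e. the unique completely additive function (so $g(1)=0$ and $g(ab)=g(a)+g(b)$ for all $a,b\in\mathbb{N}$) such that $g(p(n))=1+g(n)$ for every $n\in\mathbb{N}$, where $p(n)$ denotes the $n$-th prime in ascending order. For $n\in\mathbb{N}$ let $G(n)=\sum_{1\le i\le n} g(i)$. Then for all $n\in\mathbb{N}$, $$G(n)\ge \frac{n}{\ln 4}\,\ln n .$$
   Context: $\mathbb{N}=\{1,2,3,\dots\}$; $p(n)$ is the $n$-th prime ($p(1)=2$, $p(2)=3$, \dots); $\ln$ is the natural logarithm. -}

module Defs where

open import Data.Nat using (ℕ; zero; suc; _+_; _*_; _≤_)
open import Data.Nat.Primality using (Prime; prime?)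
open import Relation.Nullary using (does)
open import Data.Bool using (if_then_else_)
open import Relation.Binary.PropositionalEquality using (_≡_)

primeCount : ℕ → ℕ
primeCount zero    = zero
primeCount (suc x) = if does (prime? (suc x)) then suc (primeCount x) else primeCount x

-- IsNthPrime n q : q is the n-th prime (1-indexed: p(1) = 2), i.e. q = p(n)
IsNthPrime : ℕ → ℕ → Set
IsNthPrime n q = Prime q × primeCount q ≡ n
  where open import Data.Product using (_×_)

record IsGIM (g : ℕ → ℕ) : Set where
  field
    g-one      : g 1 ≡ 0
    g-additive : ∀ a b → 1 ≤ a → 1 ≤ b → g (a * b) ≡ g a + g b
    g-prime    : ∀ n q → 1 ≤ n → IsNthPrime n q → g q ≡ suc (g n)

G : (ℕ → ℕ) → ℕ → ℕ
G g zero    = zero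
G g (suc n) = G g n + g (suc n)

-- Let T c be the number of m ≤ N with g m = c.  Splitting off a prime factor, m = p * k gives
-- g m = 1 + g (π p) + g k with π = primeCount injective on primes, so T 0 ≤ 1 and
-- T (a + 1) ≤ Σ_{b ≤ a} T b * T (a - b).  Comparing the convolution powers of T with ballot numbers
-- bounds T c by the Catalan number C_c, and (c + 1) C_c = (2c choose c) ≤ 4^c.  Hence at most
-- S e = C_0 + … + C_e = catalanSum (suc e) integers m ≤ n have g m ≤ e, and the layer-cake formula gives
-- G n ≥ Σ_e (n - S e)⁺ =: G⁻ n.  Finally n^n ≤ 4^(G⁻ n) by induction on n: passing from n to n + 1
-- adds one to the exponent for every level e with S e ≤ n, and if k is the first level with n < S k,
-- then n + 1 ≤ S k ≤ 4^(k - 1), so (n + 1)^(n + 1) ≤ 4 (n + 1) n^n ≤ 4^k n^n, as (1 + 1/n)^n ≤ 4.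
module Submission where

open import Defs
open import Data.Bool using (true; false; if_then_else_)
open import Data.List.Base
  using (List; []; _∷_; _++_; length; map; concat; filter; applyUpTo; applyDownFrom; cartesianProductWith)
open import Data.List.Membership.Propositional using (_∈_)
open import Data.List.Membership.Propositional.Properties
  using ( ∈-∃++; ∈-++⁻; ∈-++⁺ˡ; ∈-++⁺ʳ; ∈-applyDownFrom⁺; ∈-applyDownFrom⁻; ∈-applyUpTo⁺
        ; ∈-concat⁺′; ∈-cartesianProductWith⁺; ∈-filter⁺; ∈-filter⁻)
open import Data.List.Properties using (length-++; length-map; length-applyDownFrom; length-filter)
open import Data.List.Relation.Unary.All as All using (_∷_)
open import Data.List.Relation.Unary.AllPairs using (_∷_)
open import Data.List.Relation.Unary.Any using (here; there)
open import Data.List.Relation.Unary.Unique.Propositional using (Unique)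
open import Data.List.Relation.Unary.Unique.Propositional.Properties using (applyDownFrom⁺₁; filter⁺)
open import Data.Nat
  using ( ℕ; zero; suc; _+_; _*_; _∸_; _^_; _≤_; _<_; z≤n; s≤s; _≤′_; ≤′-refl; ≤′-step
        ; >-nonZero; nonTrivial⇒n>1)
open import Data.Nat.ListAction using (sum; product)
open import Data.Nat.Primality using (Prime; prime?; prime⇒nonTrivial; productOfPrimes≥1)
open import Data.Nat.Primality.Factorisation using (factorise)
open import Data.Nat.Properties
open import Algebra.Properties.CommutativeSemigroup +-commutativeSemigroup
  using () renaming (interchange to +-interchange)
open import Data.Nat.Tactic.RingSolver using (solve-∀)
open import Data.Product using (Σ-syntax; _×_; _,_; proj₁; proj₂)
open import Data.Sum using (inj₁; inj₂)
open import Relation.Binary using (tri<; tri≈; tri>)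
open import Relation.Binary.PropositionalEquality
  using (_≡_; _≢_; refl; sym; trans; cong; cong₂; subst; module ≡-Reasoning)
open import Relation.Nullary using (Dec; yes; no; does; ¬_; contradiction)
open import Relation.Nullary.Decidable using (dec-true; _×-dec_)
open import Relation.Unary using (Decidable)

-- Finite sums and convolution

∑< : ℕ → (ℕ → ℕ) → ℕ
∑< k F = sum (applyUpTo F k)

syntax ∑< k (λ b → e) = ∑[ b < k ] e

∑-cong : ∀ k {F F′ : ℕ → ℕ} → (∀ b → F b ≡ F′ b) → ∑< k F ≡ ∑< k F′
∑-cong zero    eq = refl
∑-cong (suc k) eq = cong₂ _+_ (eq 0) (∑-cong k (λ b → eq (suc b)))

∑-mono-≤ : ∀ k {F F′ : ℕ → ℕ} → (∀ b → F b ≤ F′ b) → ∑< k F ≤ ∑< k F′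
∑-mono-≤ zero    le = z≤n
∑-mono-≤ (suc k) le = +-mono-≤ (le 0) (∑-mono-≤ k (λ b → le (suc b)))

∑-zero : ∀ k → ∑[ b < k ] 0 ≡ 0
∑-zero zero    = refl
∑-zero (suc k) = ∑-zero k

∑-distrib-+ : ∀ k (F F′ : ℕ → ℕ) → ∑[ b < k ] (F b + F′ b) ≡ ∑< k F + ∑< k F′
∑-distrib-+ zero    F F′ = refl
∑-distrib-+ (suc k) F F′ =
  trans (cong (F 0 + F′ 0 +_) (∑-distrib-+ k (λ b → F (suc b)) (λ b → F′ (suc b))))
        (+-interchange (F 0) (F′ 0) _ _)

*-distribˡ-∑ : ∀ k c (F : ℕ → ℕ) → c * ∑< k F ≡ ∑[ b < k ] (c * F b)
*-distribˡ-∑ zero    c F = *-zeroʳ c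
*-distribˡ-∑ (suc k) c F =
  trans (*-distribˡ-+ c (F 0) _) (cong (c * F 0 +_) (*-distribˡ-∑ k c (λ b → F (suc b))))

∑-≤-∑-suc : ∀ k (F : ℕ → ℕ) → ∑< k F ≤ ∑< (suc k) F
∑-≤-∑-suc zero    F = z≤n
∑-≤-∑-suc (suc k) F = +-monoʳ-≤ (F 0) (∑-≤-∑-suc k (λ b → F (suc b)))

∑-mono-<-prefix : ∀ {j} k {F F′ : ℕ → ℕ} → j ≤ k → (∀ b → F b ≤ F′ b) →
                  (∀ b → b < j → F b < F′ b) → j + ∑< k F ≤ ∑< k F′
∑-mono-<-prefix zero    z≤n le lt = z≤n
∑-mono-<-prefix (suc k) z≤n le lt = ∑-mono-≤ (suc k) le
∑-mono-<-prefix {suc j} (suc k) {F} {F′} (s≤s j≤k) le lt = begin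
  suc j + (F 0 + ∑[ b < k ] F (suc b))
    ≡⟨ regroup j (F 0) _ ⟩
  suc (F 0) + (j + ∑[ b < k ] F (suc b))
    ≤⟨ +-mono-≤ (lt 0 (s≤s z≤n))
                (∑-mono-<-prefix k j≤k (λ b → le (suc b)) (λ b b<j → lt (suc b) (s≤s b<j))) ⟩
  F′ 0 + ∑[ b < k ] F′ (suc b) ∎
  where
  open ≤-Reasoning
  regroup : ∀ j x s → suc j + (x + s) ≡ suc x + (j + s)
  regroup = solve-∀

infixl 7 _⋆_

_⋆_ : (ℕ → ℕ) → (ℕ → ℕ) → ℕ → ℕ
(f ⋆ h) e = ∑[ b < suc e ] (f b * h (e ∸ b))

⋆-monoˡ-≤ : ∀ e {f f′ : ℕ → ℕ} h → (∀ a → f a ≤ f′ a) → (f ⋆ h) e ≤ (f′ ⋆ h) e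
⋆-monoˡ-≤ e h le = ∑-mono-≤ (suc e) (λ b → *-monoˡ-≤ (h (e ∸ b)) (le b))

⋆-linearˡ : ∀ e c (u v h : ℕ → ℕ) → ((λ a → c * u a + v a) ⋆ h) e ≡ c * (u ⋆ h) e + (v ⋆ h) e
⋆-linearˡ e c u v h = begin
  ∑[ b < suc e ] ((c * u b + v b) * h (e ∸ b))
    ≡⟨ ∑-cong (suc e) (λ b → distrib c (u b) (v b) (h (e ∸ b))) ⟩
  ∑[ b < suc e ] (c * (u b * h (e ∸ b)) + v b * h (e ∸ b))
    ≡⟨ ∑-distrib-+ (suc e) (λ b → c * (u b * h (e ∸ b))) (λ b → v b * h (e ∸ b)) ⟩
  ∑[ b < suc e ] (c * (u b * h (e ∸ b))) + (v ⋆ h) e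
    ≡⟨ cong (_+ (v ⋆ h) e) (sym (*-distribˡ-∑ (suc e) c (λ b → u b * h (e ∸ b)))) ⟩
  c * (u ⋆ h) e + (v ⋆ h) e ∎
  where
  open ≡-Reasoning
  distrib : ∀ c x y z → (c * x + y) * z ≡ c * (x * z) + y * z
  distrib = solve-∀

⋆-assoc : ∀ e (f g h : ℕ → ℕ) → ((f ⋆ g) ⋆ h) e ≡ (f ⋆ (g ⋆ h)) e
⋆-assoc zero    f g h = regroup₀ (f 0) (g 0) (h 0)
  where
  regroup₀ : ∀ x y z → (x * y + 0) * z + 0 ≡ x * (y * z + 0) + 0
  regroup₀ = solve-∀
⋆-assoc (suc e) f g h = begin
  (f ⋆ g) 0 * h (suc e) + ((λ a → f 0 * g₊ a + (f₊ ⋆ g) a) ⋆ h) e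
    ≡⟨ cong ((f ⋆ g) 0 * h (suc e) +_) (⋆-linearˡ e (f 0) g₊ (f₊ ⋆ g) h) ⟩
  (f ⋆ g) 0 * h (suc e) + (f 0 * (g₊ ⋆ h) e + ((f₊ ⋆ g) ⋆ h) e)
    ≡⟨ cong (λ t → (f ⋆ g) 0 * h (suc e) + (f 0 * (g₊ ⋆ h) e + t)) (⋆-assoc e f₊ g h) ⟩
  (f 0 * g 0 + 0) * h (suc e) + (f 0 * (g₊ ⋆ h) e + (f₊ ⋆ (g ⋆ h)) e)
    ≡⟨ regroup (f 0) (g 0) (h (suc e)) ((g₊ ⋆ h) e) ((f₊ ⋆ (g ⋆ h)) e) ⟩
  f 0 * (g 0 * h (suc e) + (g₊ ⋆ h) e) + (f₊ ⋆ (g ⋆ h)) e ∎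
  where
  open ≡-Reasoning
  f₊ g₊ : ℕ → ℕ
  f₊ a = f (suc a)
  g₊ a = g (suc a)
  regroup : ∀ x y z p q → (x * y + 0) * z + (x * p + q) ≡ x * (y * z + p) + q
  regroup = solve-∀

δ : ℕ → ℕ
δ zero    = 1
δ (suc _) = 0

⋆-identityʳ : ∀ e f → (f ⋆ δ) e ≡ f e
⋆-identityʳ zero    f = trans (+-identityʳ _) (*-identityʳ (f 0))
⋆-identityʳ (suc e) f =
  trans (cong (_+ ((λ a → f (suc a)) ⋆ δ) e) (*-zeroʳ (f 0))) (⋆-identityʳ e (λ a → f (suc a)))

_^⋆_ : (ℕ → ℕ) → ℕ → ℕ → ℕ
T ^⋆ zero  = δ
T ^⋆ suc d = T ⋆ (T ^⋆ d)

-- Catalan numbers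

-- If C = 1 + x C², then C^(d+1) = C^d + x C^(d+2); ballot d e is the coefficient of x^e in C^d.
ballot : ℕ → ℕ → ℕ
ballot d       zero    = 1
ballot zero    (suc e) = 0
ballot (suc d) (suc e) = ballot d (suc e) + ballot (suc (suc d)) e

catalan : ℕ → ℕ
catalan = ballot 1

ballot-pos : ∀ d e → 1 ≤ ballot (suc d) e
ballot-pos d zero    = ≤-refl
ballot-pos d (suc e) = ≤-trans (ballot-pos (suc d) e) (m≤n+m _ (ballot d (suc e)))

module _ {T : ℕ → ℕ} (T₀≤1 : T 0 ≤ 1) (T-suc : ∀ a → T (suc a) ≤ (T ⋆ T) a) where

  ^⋆-zero-≤ : ∀ d → (T ^⋆ d) 0 ≤ 1
  ^⋆-zero-≤ zero    = ≤-refl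
  ^⋆-zero-≤ (suc d) = ≤-trans (≤-reflexive (+-identityʳ _)) (*-mono-≤ T₀≤1 (^⋆-zero-≤ d))

  ^⋆-suc-≤ : ∀ d e → (T ^⋆ suc d) (suc e) ≤ (T ^⋆ d) (suc e) + (T ^⋆ suc (suc d)) e
  ^⋆-suc-≤ d e = begin
    T 0 * P (suc e) + ((λ a → T (suc a)) ⋆ P) e
      ≤⟨ +-mono-≤ (≤-trans (*-monoˡ-≤ (P (suc e)) T₀≤1) (≤-reflexive (*-identityˡ _)))
                  (⋆-monoˡ-≤ e P T-suc) ⟩
    P (suc e) + ((T ⋆ T) ⋆ P) e
      ≡⟨ cong (P (suc e) +_) (⋆-assoc e T T P) ⟩
    P (suc e) + (T ⋆ (T ⋆ P)) e ∎
    where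
    open ≤-Reasoning
    P : ℕ → ℕ
    P = T ^⋆ d

  ^⋆-≤-ballot : ∀ d e → (T ^⋆ d) e ≤ ballot d e
  ^⋆-≤-ballot d       zero    = ^⋆-zero-≤ d
  ^⋆-≤-ballot zero    (suc e) = z≤n
  ^⋆-≤-ballot (suc d) (suc e) =
    ≤-trans (^⋆-suc-≤ d e) (+-mono-≤ (^⋆-≤-ballot d (suc e)) (^⋆-≤-ballot (suc (suc d)) e))

  ≤-catalan : ∀ e → T e ≤ catalan e
  ≤-catalan e = subst (_≤ catalan e) (⋆-identityʳ e T) (^⋆-≤-ballot 1 e)

-- paths a b = (a + b choose a), the number of monotone lattice paths from (0,0) to (a,b).
paths : ℕ → ℕ → ℕ
paths zero    b       = 1
paths (suc a) zero    = 1
paths (suc a) (suc b) = paths a (suc b) + paths (suc a) b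

paths-zeroʳ : ∀ a → paths a 0 ≡ 1
paths-zeroʳ zero    = refl
paths-zeroʳ (suc a) = refl

paths-sym : ∀ a b → paths a b ≡ paths b a
paths-sym zero    b       = sym (paths-zeroʳ b)
paths-sym (suc a) zero    = refl
paths-sym (suc a) (suc b) =
  trans (cong₂ _+_ (paths-sym a (suc b)) (paths-sym (suc a) b)) (+-comm (paths (suc b) a) _)

paths-absorbˡ : ∀ a b → suc a * paths (suc a) b ≡ suc (a + b) * paths a b
paths-absorbʳ : ∀ a b → suc b * paths a (suc b) ≡ suc (a + b) * paths a b

paths-absorbˡ a zero    =
  cong₂ (λ x y → suc x * y) (sym (+-identityʳ a)) (sym (paths-zeroʳ a))
paths-absorbˡ a (suc b) = begin
  suc a * (paths a (suc b) + paths (suc a) b)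
    ≡⟨ *-distribˡ-+ (suc a) (paths a (suc b)) _ ⟩
  suc a * paths a (suc b) + suc a * paths (suc a) b
    ≡⟨ cong (suc a * paths a (suc b) +_) (trans (paths-absorbˡ a b) (sym (paths-absorbʳ a b))) ⟩
  suc a * paths a (suc b) + suc b * paths a (suc b)
    ≡⟨ sym (*-distribʳ-+ (paths a (suc b)) (suc a) (suc b)) ⟩
  suc (a + suc b) * paths a (suc b) ∎
  where open ≡-Reasoning
paths-absorbʳ zero    b = refl
paths-absorbʳ (suc a) b = begin
  suc b * (paths a (suc b) + paths (suc a) b)
    ≡⟨ *-distribˡ-+ (suc b) (paths a (suc b)) _ ⟩
  suc b * paths a (suc b) + suc b * paths (suc a) b
    ≡⟨ cong (_+ suc b * paths (suc a) b) (trans (paths-absorbʳ a b) (sym (paths-absorbˡ a b))) ⟩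
  suc a * paths (suc a) b + suc b * paths (suc a) b
    ≡⟨ sym (*-distribʳ-+ (paths (suc a) b) (suc a) (suc b)) ⟩
  suc (a + suc b) * paths (suc a) b
    ≡⟨ cong (λ x → suc x * paths (suc a) b) (+-suc a b) ⟩
  suc (suc a + b) * paths (suc a) b ∎
  where open ≡-Reasoning

paths-≤-2^ : ∀ a b → paths a b ≤ 2 ^ (a + b)
paths-≤-2^ zero    b       = m^n>0 2 b
paths-≤-2^ (suc a) zero    = m^n>0 2 (suc a + 0)
paths-≤-2^ (suc a) (suc b) = begin
  paths a (suc b) + paths (suc a) b
    ≤⟨ +-mono-≤ (paths-≤-2^ a (suc b)) (paths-≤-2^ (suc a) b) ⟩
  2 ^ (a + suc b) + 2 ^ suc (a + b)
    ≡⟨ cong (λ n → 2 ^ n + 2 ^ suc (a + b)) (+-suc a b) ⟩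
  2 ^ suc (a + b) + 2 ^ suc (a + b)
    ≡⟨ cong (2 ^ suc (a + b) +_) (sym (+-identityʳ _)) ⟩
  2 ^ suc (suc (a + b))
    ≡⟨ cong (λ n → 2 ^ suc n) (sym (+-suc a b)) ⟩
  2 ^ (suc a + suc b) ∎
  where open ≤-Reasoning

paths-diagonal-≤-4^ : ∀ f → paths f f ≤ 4 ^ f
paths-diagonal-≤-4^ f = begin
  paths f f       ≤⟨ paths-≤-2^ f f ⟩
  2 ^ (f + f)     ≡⟨ cong (λ x → 2 ^ (f + x)) (sym (+-identityʳ f)) ⟩
  2 ^ (2 * f)     ≡⟨ sym (^-*-assoc 2 2 f) ⟩
  4 ^ f           ∎
  where open ≤-Reasoning

ballot-paths : ∀ d e → ballot d (suc e) + paths e (suc (d + e)) ≡ paths (suc e) (d + e)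
ballot-paths zero    e       = paths-sym e (suc e)
ballot-paths (suc d) zero    = trans (cong (_+ 1) (ballot-paths d 0)) (+-comm (paths 1 (d + 0)) 1)
ballot-paths (suc d) (suc e) = begin
  ballot d (suc (suc e)) + ballot (suc (suc d)) (suc e) + (paths e (suc (suc s)) + paths (suc e) (suc s))
    ≡⟨ regroup (ballot d (suc (suc e))) _ _ _ ⟩
  (ballot (suc (suc d)) (suc e) + paths e (suc (suc s))) + (ballot d (suc (suc e)) + paths (suc e) (suc s))
    ≡⟨ cong₂ _+_ shifted (ballot-paths d (suc e)) ⟩
  paths (suc e) (suc s) + paths (suc (suc e)) s ∎
  where
  open ≡-Reasoning
  s : ℕ
  s = d + suc e
  regroup : ∀ a b c x → a + b + (c + x) ≡ (b + c) + (a + x)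
  regroup = solve-∀
  shifted : ballot (suc (suc d)) (suc e) + paths e (suc (suc s)) ≡ paths (suc e) (suc s)
  shifted = subst (λ t → ballot (suc (suc d)) (suc e) + paths e (suc (suc t)) ≡ paths (suc e) (suc t))
                  (sym (+-suc d e)) (ballot-paths (suc (suc d)) e)

catalan-paths : ∀ f → suc f * catalan f ≡ paths f f
catalan-paths zero    = refl
catalan-paths (suc e) = +-cancelʳ-≡ _ _ _ (begin
  suc (suc e) * c + suc e * W       ≡⟨ cong (suc (suc e) * c +_) (sym absorb) ⟩
  suc (suc e) * c + suc (suc e) * X ≡⟨ sym (*-distribˡ-+ (suc (suc e)) c X) ⟩
  suc (suc e) * (c + X)             ≡⟨ cong (suc (suc e) *_) (ballot-paths 1 e) ⟩
  W + suc e * W                     ∎)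
  where
  open ≡-Reasoning
  c X W : ℕ
  c = catalan (suc e)
  X = paths e (suc (suc e))
  W = paths (suc e) (suc e)
  absorb : suc (suc e) * X ≡ suc e * W
  absorb = trans (paths-absorbʳ e (suc e)) (sym (paths-absorbˡ e (suc e)))

catalan-bound : ∀ f → suc f * catalan f ≤ 4 ^ f
catalan-bound f = ≤-trans (≤-reflexive (catalan-paths f)) (paths-diagonal-≤-4^ f)

catalanSum : ℕ → ℕ
catalanSum zero    = 0
catalanSum (suc k) = catalanSum k + catalan k

catalanSum-< : ∀ k → catalanSum k < catalanSum (suc k)
catalanSum-< k = m<m+n (catalanSum k) (ballot-pos 0 k)

catalanSum-≥ : ∀ k → k ≤ catalanSum k
catalanSum-≥ zero    = z≤n
catalanSum-≥ (suc k) = ≤-trans (s≤s (catalanSum-≥ k)) (catalanSum-< k)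

catalan-≤-3*4^ : ∀ j → catalan (5 + j) ≤ 3 * 4 ^ (3 + j)
catalan-≤-3*4^ j = *-cancelˡ-≤ 6 (begin
  6 * c               ≤⟨ *-monoˡ-≤ c (m≤m+n 6 j) ⟩
  (6 + j) * c         ≤⟨ catalan-bound (5 + j) ⟩
  4 * (4 * X)         ≤⟨ m≤m+n (4 * (4 * X)) (2 * X) ⟩
  4 * (4 * X) + 2 * X ≡⟨ regroup X ⟩
  6 * (3 * X)         ∎)
  where
  open ≤-Reasoning
  c X : ℕ
  c = catalan (5 + j)
  X = 4 ^ (3 + j)
  regroup : ∀ X → 4 * (4 * X) + 2 * X ≡ 6 * (3 * X)
  regroup = solve-∀

catalanSum-≤-4^ : ∀ i → catalanSum (3 + i) ≤ 4 ^ (1 + i)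
catalanSum-≤-4^ 0 = ≤-refl
catalanSum-≤-4^ 1 = ≤ᵇ⇒≤ (catalanSum 4) (4 ^ 2) _
catalanSum-≤-4^ 2 = ≤ᵇ⇒≤ (catalanSum 5) (4 ^ 3) _
catalanSum-≤-4^ (suc (suc (suc j))) = begin
  catalanSum (5 + j) + catalan (5 + j)
    ≤⟨ +-mono-≤ (catalanSum-≤-4^ (suc (suc j))) (catalan-≤-3*4^ j) ⟩
  X + 3 * X
    ≡⟨ regroup X ⟩
  4 ^ (4 + j) ∎
  where
  open ≤-Reasoning
  X : ℕ
  X = 4 ^ (3 + j)
  regroup : ∀ X → X + 3 * X ≡ 4 * X
  regroup = solve-∀

-- The bound n^n ≤ 4^(G⁻ n)

bernoulli : ∀ m k → suc m ^ suc k ≤ m ^ k * suc m + k * suc m ^ k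
bernoulli m zero    = ≤-reflexive (base m)
  where
  base : ∀ m → (1 + m) * 1 ≡ 1 * (1 + m) + 0 * 1
  base = solve-∀
bernoulli m (suc k) = begin
  suc m * (suc m * B)                           ≡⟨ e₁ m B ⟩
  m * (suc m * B) + suc m * B                   ≤⟨ +-monoˡ-≤ (suc m * B) (*-monoʳ-≤ m (bernoulli m k)) ⟩
  m * (a * suc m + k * B) + suc m * B           ≡⟨ e₂ m a B k ⟩
  m * a * suc m + suc m * B + m * k * B         ≤⟨ m≤m+n _ (k * B) ⟩
  m * a * suc m + suc m * B + m * k * B + k * B ≡⟨ e₃ m a B k ⟩
  m * a * suc m + suc k * (suc m * B)           ∎
  where
  open ≤-Reasoning
  a B : ℕ
  a = m ^ k
  B = suc m ^ k
  e₁ : ∀ m B → (1 + m) * ((1 + m) * B) ≡ m * ((1 + m) * B) + (1 + m) * B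
  e₁ = solve-∀
  e₂ : ∀ m a B k → m * (a * (1 + m) + k * B) + (1 + m) * B ≡ m * a * (1 + m) + (1 + m) * B + m * k * B
  e₂ = solve-∀
  e₃ : ∀ m a B k → m * a * (1 + m) + (1 + m) * B + m * k * B + k * B ≡ m * a * (1 + m) + (1 + k) * ((1 + m) * B)
  e₃ = solve-∀

half-power-≤ : ∀ n q → 2 * q ≤ suc n → suc n ^ q ≤ 2 * n ^ q
half-power-≤ n q 2q≤1+n = *-cancelˡ-≤ (suc n) (+-cancelʳ-≤ (suc n * B) _ _ (begin
  suc n * B + suc n * B       ≡⟨ e₁ n B ⟩
  2 * (suc n * B)             ≤⟨ *-monoʳ-≤ 2 (bernoulli n q) ⟩
  2 * (a * suc n + q * B)     ≡⟨ e₂ a n q B ⟩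
  suc n * (2 * a) + 2 * q * B ≤⟨ +-monoʳ-≤ (suc n * (2 * a)) (*-monoˡ-≤ B 2q≤1+n) ⟩
  suc n * (2 * a) + suc n * B ∎))
  where
  open ≤-Reasoning
  a B : ℕ
  a = n ^ q
  B = suc n ^ q
  e₁ : ∀ n B → (1 + n) * B + (1 + n) * B ≡ 2 * ((1 + n) * B)
  e₁ = solve-∀
  e₂ : ∀ a n q B → 2 * (a * (1 + n) + q * B) ≡ (1 + n) * (2 * a) + 2 * q * B
  e₂ = solve-∀

halves : ∀ n → Σ[ q ∈ ℕ ] Σ[ r ∈ ℕ ] q + r ≡ n × 2 * q ≤ suc n × 2 * r ≤ n
halves zero    = 0 , 0 , refl , z≤n , z≤n
halves (suc n) with q , r , q+r≡n , 2q≤1+n , 2r≤n ← halves n =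
  suc r , q , cong suc (trans (+-comm r q) q+r≡n) ,
  ≤-trans (≤-reflexive (*-suc 2 r)) (s≤s (s≤s 2r≤n)) , 2q≤1+n

suc-power-≤ : ∀ n → suc n ^ n ≤ 4 * n ^ n
suc-power-≤ n with q , r , refl , 2q≤1+n , 2r≤n ← halves n = begin
  suc n ^ (q + r)         ≡⟨ ^-distribˡ-+-* (suc n) q r ⟩
  suc n ^ q * suc n ^ r   ≤⟨ *-mono-≤ (half-power-≤ n q 2q≤1+n) (half-power-≤ n r (m≤n⇒m≤1+n 2r≤n)) ⟩
  2 * n ^ q * (2 * n ^ r) ≡⟨ regroup (n ^ q) (n ^ r) ⟩
  4 * (n ^ q * n ^ r)     ≡⟨ cong (4 *_) (sym (^-distribˡ-+-* n q r)) ⟩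
  4 * n ^ (q + r)         ∎
  where
  open ≤-Reasoning
  regroup : ∀ x y → 2 * x * (2 * y) ≡ 4 * (x * y)
  regroup = solve-∀

G⁻ : ℕ → ℕ
G⁻ n = ∑[ e < n ] (n ∸ catalanSum (suc e))

first-exceeding : ∀ n → Σ[ k ∈ ℕ ] n < catalanSum (suc k) × (∀ e → e < k → catalanSum (suc e) ≤ n)
first-exceeding zero    = 0 , s≤s z≤n , λ _ ()
first-exceeding (suc n) with k , n<S , below ← first-exceeding n | suc n <? catalanSum (suc k)
... | yes 1+n<S = k , 1+n<S , λ e e<k → m≤n⇒m≤1+n (below e e<k)
... | no  1+n≮S = suc k , subst (_< catalanSum (suc (suc k))) S≡1+n (catalanSum-< (suc k)) , below′
  where
  S≡1+n : catalanSum (suc k) ≡ suc n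
  S≡1+n = ≤-antisym (≮⇒≥ 1+n≮S) n<S
  below′ : ∀ e → e < suc k → catalanSum (suc e) ≤ suc n
  below′ e (s≤s e≤k) with m≤n⇒m<n∨m≡n e≤k
  ... | inj₁ e<k  = m≤n⇒m≤1+n (below e e<k)
  ... | inj₂ refl = ≤-reflexive S≡1+n

G⁻-suc : ∀ n k → k ≤ n → (∀ e → e < k → catalanSum (suc e) ≤ n) → k + G⁻ n ≤ G⁻ (suc n)
G⁻-suc n k k≤n below = begin
  k + ∑[ e < n ] (n ∸ catalanSum (suc e))
    ≤⟨ ∑-mono-<-prefix n k≤n (λ e → ∸-monoˡ-≤ (catalanSum (suc e)) (n≤1+n n))
                             (λ e e<k → ≤-reflexive (sym (+-∸-assoc 1 (below e e<k)))) ⟩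
  ∑[ e < n ] (suc n ∸ catalanSum (suc e))
    ≤⟨ ∑-≤-∑-suc n (λ e → suc n ∸ catalanSum (suc e)) ⟩
  G⁻ (suc n) ∎
  where open ≤-Reasoning

self-power-step : ∀ n → 2 ≤ n → n ^ n ≤ 4 ^ G⁻ n → suc n ^ suc n ≤ 4 ^ G⁻ (suc n)
self-power-step n 2≤n ih with first-exceeding n
... | zero     , n<1 , _ = contradiction (≤-trans (s≤s z≤n) 2≤n) (<⇒≱ n<1)
... | suc zero , n<2 , _ = contradiction 2≤n (<⇒≱ n<2)
... | k@(suc (suc j)) , n<S , below = begin
  suc n * suc n ^ n       ≤⟨ *-mono-≤ (≤-trans n<S (catalanSum-≤-4^ j)) (suc-power-≤ n) ⟩
  4 ^ suc j * (4 * n ^ n) ≡⟨ regroup (4 ^ suc j) (n ^ n) ⟩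
  4 ^ k * n ^ n           ≤⟨ *-monoʳ-≤ (4 ^ k) ih ⟩
  4 ^ k * 4 ^ G⁻ n        ≡⟨ sym (^-distribˡ-+-* 4 k (G⁻ n)) ⟩
  4 ^ (k + G⁻ n)          ≤⟨ ^-monoʳ-≤ 4 (G⁻-suc n k k≤n below) ⟩
  4 ^ G⁻ (suc n)          ∎
  where
  open ≤-Reasoning
  regroup : ∀ x y → x * (4 * y) ≡ 4 * x * y
  regroup = solve-∀
  k≤n : k ≤ n
  k≤n = ≤-trans (catalanSum-≥ k) (below (suc j) ≤-refl)

self-power-≤ : ∀ n → suc n ^ suc n ≤ 4 ^ G⁻ (suc n)
self-power-≤ zero          = ≤-refl
self-power-≤ (suc zero)    = ≤-refl
self-power-≤ (suc (suc n)) = self-power-step (suc (suc n)) (s≤s (s≤s z≤n)) (self-power-≤ (suc n))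

prime⇒≥2 : ∀ {p} → Prime p → 2 ≤ p
prime⇒≥2 {p} pr = nonTrivial⇒n>1 p {{prime⇒nonTrivial pr}}

primeCount-suc-≤ : ∀ x → primeCount x ≤ primeCount (suc x)
primeCount-suc-≤ x with does (prime? (suc x))
... | true  = n≤1+n _
... | false = ≤-refl

primeCount-suc-≤-suc : ∀ x → primeCount (suc x) ≤ suc (primeCount x)
primeCount-suc-≤-suc x with does (prime? (suc x))
... | true  = ≤-refl
... | false = n≤1+n _

primeCount-prime : ∀ x → Prime (suc x) → primeCount (suc x) ≡ suc (primeCount x)
primeCount-prime x pr rewrite dec-true (prime? (suc x)) pr = refl

primeCount-≤ : ∀ x → primeCount x ≤ x
primeCount-≤ zero    = z≤n
primeCount-≤ (suc x) = ≤-trans (primeCount-suc-≤-suc x) (s≤s (primeCount-≤ x))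

primeCount-mono-≤ : ∀ {x y} → x ≤ y → primeCount x ≤ primeCount y
primeCount-mono-≤ x≤y = mono (≤⇒≤′ x≤y)
  where
  mono : ∀ {x y} → x ≤′ y → primeCount x ≤ primeCount y
  mono             ≤′-refl        = ≤-refl
  mono {y = suc y} (≤′-step x≤′y) = ≤-trans (mono x≤′y) (primeCount-suc-≤ y)

primeCount-<-prime : ∀ {p q} → Prime q → p < q → primeCount p < primeCount q
primeCount-<-prime {q = suc q} pr (s≤s p≤q) =
  ≤-trans (s≤s (primeCount-mono-≤ p≤q)) (≤-reflexive (sym (primeCount-prime q pr)))

primeCount-prime-pos : ∀ {p} → Prime p → 1 ≤ primeCount p
primeCount-prime-pos pr = primeCount-<-prime pr (≤-trans (s≤s z≤n) (prime⇒≥2 pr))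

primeCount-injective : ∀ {p q} → Prime p → Prime q → primeCount p ≡ primeCount q → p ≡ q
primeCount-injective {p} {q} prp prq eq with <-cmp p q
... | tri< p<q _ _ = contradiction eq (<⇒≢ (primeCount-<-prime prq p<q))
... | tri≈ _ p≡q _ = p≡q
... | tri> _ _ q<p = contradiction (sym eq) (<⇒≢ (primeCount-<-prime prp q<p))

record PrimeSplit (m : ℕ) : Set where
  field
    p k   : ℕ
    prime : Prime p
    1≤k   : 1 ≤ k
    m≡p*k : m ≡ p * k

  p≤m : p ≤ m
  p≤m = subst (p ≤_) (sym m≡p*k) (m≤m*n p k {{>-nonZero 1≤k}})

  k≤m : k ≤ m
  k≤m = subst (k ≤_) (sym m≡p*k) (m≤n*m k p {{>-nonZero (≤-trans (s≤s z≤n) (prime⇒≥2 prime))}})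

prime-split : ∀ {m} → 2 ≤ m → PrimeSplit m
prime-split {m} 2≤m with factorise m {{>-nonZero (≤-trans (s≤s z≤n) 2≤m)}}
... | record { factors = [] ; isFactorisation = m≡1 } = contradiction (sym m≡1) (<⇒≢ 2≤m)
... | record { factors = p ∷ ps ; isFactorisation = m≡p*k ; factorsPrime = pr ∷ prs } =
  record { p = p ; k = product ps ; prime = pr ; 1≤k = productOfPrimes≥1 prs ; m≡p*k = m≡p*k }

-- Counting in lists

range : ℕ → List ℕ
range = applyDownFrom suc

∈-range⁺ : ∀ {m n} → 1 ≤ m → m ≤ n → m ∈ range n
∈-range⁺ {suc i} _ i<n = ∈-applyDownFrom⁺ suc i<n

∈-range⁻ : ∀ {m n} → m ∈ range n → 1 ≤ m × m ≤ n
∈-range⁻ m∈ with i , i<n , refl ← ∈-applyDownFrom⁻ suc m∈ = s≤s z≤n , i<n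

range-unique : ∀ n → Unique (range n)
range-unique n = applyDownFrom⁺₁ suc n (λ j<i _ 1+i≡1+j → <⇒≢ j<i (sym (suc-injective 1+i≡1+j)))

length-range : ∀ n → length (range n) ≡ n
length-range = length-applyDownFrom suc

length-≤-injection : ∀ {A B : Set} (f : A → B) {xs : List A} {ys : List B} → Unique xs →
                     (∀ {x y} → x ∈ xs → y ∈ xs → f x ≡ f y → x ≡ y) →
                     (∀ {x} → x ∈ xs → f x ∈ ys) → length xs ≤ length ys
length-≤-injection f {[]}     _             _   _    = z≤n
length-≤-injection f {x ∷ xs} (x∉xs ∷ uniq) inj into
  with as , bs , refl ← ∈-∃++ (into (here refl)) = begin
    suc (length xs)               ≤⟨ s≤s (length-≤-injection f uniq (λ x∈ y∈ → inj (there x∈) (there y∈)) into′) ⟩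
    suc (length (as ++ bs))       ≡⟨ cong suc (length-++ as) ⟩
    suc (length as + length bs)   ≡⟨ sym (+-suc (length as) (length bs)) ⟩
    length as + length (f x ∷ bs) ≡⟨ sym (length-++ as) ⟩
    length (as ++ f x ∷ bs)       ∎
  where
  open ≤-Reasoning
  into′ : ∀ {y} → y ∈ xs → f y ∈ as ++ bs
  into′ y∈xs with ∈-++⁻ as (into (there y∈xs))
  ... | inj₁ ∈as          = ∈-++⁺ˡ ∈as
  ... | inj₂ (here fy≡fx) = contradiction (sym (inj (there y∈xs) (here refl) fy≡fx)) (All.lookup x∉xs y∈xs)
  ... | inj₂ (there ∈bs)  = ∈-++⁺ʳ as ∈bs

length-≤-⊆ : ∀ {A : Set} {xs ys : List A} → Unique xs → (∀ {x} → x ∈ xs → x ∈ ys) → length xs ≤ length ys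
length-≤-⊆ uniq ⊆ = length-≤-injection (λ x → x) uniq (λ _ _ x≡y → x≡y) ⊆

length-concat-applyUpTo : ∀ {A : Set} k (F : ℕ → List A) → length (concat (applyUpTo F k)) ≡ ∑[ b < k ] length (F b)
length-concat-applyUpTo zero    F = refl
length-concat-applyUpTo (suc k) F =
  trans (length-++ (F 0)) (cong (length (F 0) +_) (length-concat-applyUpTo k (λ b → F (suc b))))

length-cartesianProductWith : ∀ {A B C : Set} (f : A → B → C) xs ys →
                              length (cartesianProductWith f xs ys) ≡ length xs * length ys
length-cartesianProductWith f []       ys = refl
length-cartesianProductWith f (x ∷ xs) ys =
  trans (length-++ (map (f x) ys)) (cong₂ _+_ (length-map (f x) ys) (length-cartesianProductWith f xs ys))

𝟙 : {P : Set} → Dec P → ℕ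
𝟙 P? = if does P? then 1 else 0

𝟙-<-suc : ∀ v e → 𝟙 (v <? suc e) ≡ 𝟙 (v <? e) + 𝟙 (v ≟ e)
𝟙-<-suc zero    zero    = refl
𝟙-<-suc zero    (suc e) = refl
𝟙-<-suc (suc v) zero    = refl
𝟙-<-suc (suc v) (suc e) = 𝟙-<-suc v e

∑-𝟙-< : ∀ k v → ∑[ e < k ] 𝟙 (e <? v) ≤ v
∑-𝟙-< zero    v       = z≤n
∑-𝟙-< (suc k) zero    = ∑-𝟙-< k zero
∑-𝟙-< (suc k) (suc v) = s≤s (∑-𝟙-< k v)

∸-𝟙-≤ : ∀ {P Q : Set} {n b} (P? : Dec P) (Q? : Dec Q) → (¬ P → Q) → b ≤ n →
        suc n ∸ (𝟙 P? + b) ≤ (n ∸ b) + 𝟙 Q?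
∸-𝟙-≤ {n = n} {b} (yes _) Q?      _     _   = m≤m+n (n ∸ b) (𝟙 Q?)
∸-𝟙-≤ {n = n} {b} (no ¬p) (yes _) _     b≤n = ≤-reflexive (trans (+-∸-assoc 1 b≤n) (+-comm 1 (n ∸ b)))
∸-𝟙-≤             (no ¬p) (no ¬q) ¬p⇒q  _   = contradiction (¬p⇒q ¬p) ¬q

module _ {A : Set} where

  length-filter-∷ : ∀ {P : A → Set} (P? : Decidable P) x xs →
                    length (filter P? (x ∷ xs)) ≡ 𝟙 (P? x) + length (filter P? xs)
  length-filter-∷ P? x xs with does (P? x)
  ... | true  = refl
  ... | false = refl

  length-filter-<-zero : ∀ (h : A → ℕ) xs → length (filter (λ x → h x <? 0) xs) ≡ 0
  length-filter-<-zero h []       = refl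
  length-filter-<-zero h (x ∷ xs) =
    trans (length-filter-∷ (λ y → h y <? 0) x xs) (length-filter-<-zero h xs)

  length-filter-<-suc : ∀ (h : A → ℕ) e xs →
                        length (filter (λ x → h x <? suc e) xs) ≡
                        length (filter (λ x → h x <? e) xs) + length (filter (λ x → h x ≟ e) xs)
  length-filter-<-suc h e []       = refl
  length-filter-<-suc h e (x ∷ xs) = begin
    length (filter (λ y → h y <? suc e) (x ∷ xs))
      ≡⟨ length-filter-∷ (λ y → h y <? suc e) x xs ⟩
    𝟙 (h x <? suc e) + length (filter (λ y → h y <? suc e) xs)
      ≡⟨ cong₂ _+_ (𝟙-<-suc (h x) e) (length-filter-<-suc h e xs) ⟩
    𝟙 (h x <? e) + 𝟙 (h x ≟ e) + (length (filter (λ y → h y <? e) xs) + length (filter (λ y → h y ≟ e) xs))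
      ≡⟨ +-interchange (𝟙 (h x <? e)) _ _ _ ⟩
    (𝟙 (h x <? e) + length (filter (λ y → h y <? e) xs)) + (𝟙 (h x ≟ e) + length (filter (λ y → h y ≟ e) xs))
      ≡⟨ sym (cong₂ _+_ (length-filter-∷ (λ y → h y <? e) x xs) (length-filter-∷ (λ y → h y ≟ e) x xs)) ⟩
    length (filter (λ y → h y <? e) (x ∷ xs)) + length (filter (λ y → h y ≟ e) (x ∷ xs)) ∎
    where open ≡-Reasoning

below : (ℕ → ℕ) → ℕ → ℕ → ℕ
below g n k = length (filter (λ m → g m <? k) (range n))

module _ (g : ℕ → ℕ) where

  below-≤ : ∀ n k → below g n k ≤ n
  below-≤ n k = ≤-trans (length-filter (λ m → g m <? k) (range n)) (≤-reflexive (length-range n))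

  below-suc : ∀ n k → below g (suc n) k ≡ 𝟙 (g (suc n) <? k) + below g n k
  below-suc n k = length-filter-∷ (λ m → g m <? k) (suc n) (range n)

  below-suc-layer : ∀ n e → suc n ∸ below g (suc n) (suc e) ≤ (n ∸ below g n (suc e)) + 𝟙 (e <? g (suc n))
  below-suc-layer n e = begin
    suc n ∸ below g (suc n) (suc e)
      ≡⟨ cong (suc n ∸_) (below-suc n (suc e)) ⟩
    suc n ∸ (𝟙 (g (suc n) <? suc e) + below g n (suc e))
      ≤⟨ ∸-𝟙-≤ (g (suc n) <? suc e) (e <? g (suc n)) (λ v≮1+e → ≤-pred (≰⇒> v≮1+e)) (below-≤ n (suc e)) ⟩
    (n ∸ below g n (suc e)) + 𝟙 (e <? g (suc n)) ∎
    where open ≤-Reasoning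

  layer-cake : ∀ k n → ∑[ e < k ] (n ∸ below g n (suc e)) ≤ G g n
  layer-cake k zero    = ≤-reflexive (∑-zero k)
  layer-cake k (suc n) = begin
    ∑[ e < k ] (suc n ∸ below g (suc n) (suc e))
      ≤⟨ ∑-mono-≤ k (below-suc-layer n) ⟩
    ∑[ e < k ] ((n ∸ below g n (suc e)) + 𝟙 (e <? g (suc n)))
      ≡⟨ ∑-distrib-+ k (λ e → n ∸ below g n (suc e)) (λ e → 𝟙 (e <? g (suc n))) ⟩
    ∑[ e < k ] (n ∸ below g n (suc e)) + ∑[ e < k ] 𝟙 (e <? g (suc n))
      ≤⟨ +-mono-≤ (layer-cake k n) (∑-𝟙-< k (g (suc n))) ⟩
    G g n + g (suc n) ∎
    where open ≤-Reasoning

-- The Gutman–Ivić–Matula function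

module _ {g : ℕ → ℕ} (gim : IsGIM g) where
  open IsGIM gim

  g-prime-primeCount : ∀ {p} → Prime p → g p ≡ suc (g (primeCount p))
  g-prime-primeCount {p} pr = g-prime (primeCount p) p (primeCount-prime-pos pr) (pr , refl)

  g-split : ∀ {m} (s : PrimeSplit m) → let open PrimeSplit s in g m ≡ suc (g (primeCount p) + g k)
  g-split {m} s = begin
    g m                          ≡⟨ cong g m≡p*k ⟩
    g (p * k)                    ≡⟨ g-additive p k (≤-trans (s≤s z≤n) (prime⇒≥2 prime)) 1≤k ⟩
    g p + g k                    ≡⟨ cong (_+ g k) (g-prime-primeCount prime) ⟩
    suc (g (primeCount p) + g k) ∎
    where
    open PrimeSplit s
    open ≡-Reasoning

  g≡0⇒≡1 : ∀ {m} → 1 ≤ m → g m ≡ 0 → m ≡ 1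
  g≡0⇒≡1 {suc zero}    _ _   = refl
  g≡0⇒≡1 {suc (suc m)} _ g≡0 = contradiction (trans (sym (g-split (prime-split (s≤s (s≤s z≤n))))) g≡0) λ ()

  g≢0⇒≥2 : ∀ {m} → 1 ≤ m → g m ≢ 0 → 2 ≤ m
  g≢0⇒≥2 {suc zero}    _ g1≢0 = contradiction g-one g1≢0
  g≢0⇒≥2 {suc (suc m)} _ _    = s≤s (s≤s z≤n)

  module Levels (N : ℕ) where

    level : ℕ → List ℕ
    level c = filter (λ m → g m ≟ c) (range N)

    levelSize : ℕ → ℕ
    levelSize c = length (level c)

    primesAt : ℕ → List ℕ
    primesAt b = filter (λ p → prime? p ×-dec g (primeCount p) ≟ b) (range N)

    level-unique : ∀ c → Unique (level c)
    level-unique c = filter⁺ (λ m → g m ≟ c) (range-unique N)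

    ∈-level⁺ : ∀ {m c} → 1 ≤ m → m ≤ N → g m ≡ c → m ∈ level c
    ∈-level⁺ 1≤m m≤N gm≡c = ∈-filter⁺ (λ m → g m ≟ _) (∈-range⁺ 1≤m m≤N) gm≡c

    ∈-level⁻ : ∀ {m c} → m ∈ level c → (1 ≤ m × m ≤ N) × g m ≡ c
    ∈-level⁻ m∈ with m∈range , gm≡c ← ∈-filter⁻ (λ m → g m ≟ _) {xs = range N} m∈ = ∈-range⁻ m∈range , gm≡c

    ∈-primesAt⁺ : ∀ {p} → p ≤ N → Prime p → p ∈ primesAt (g (primeCount p))
    ∈-primesAt⁺ p≤N pr = ∈-filter⁺ (λ q → prime? q ×-dec g (primeCount q) ≟ _)
                                    (∈-range⁺ (≤-trans (s≤s z≤n) (prime⇒≥2 pr)) p≤N) (pr , refl)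

    ∈-primesAt⁻ : ∀ {p b} → p ∈ primesAt b → p ≤ N × Prime p × g (primeCount p) ≡ b
    ∈-primesAt⁻ p∈ with p∈range , pr , g≡b ← ∈-filter⁻ (λ q → prime? q ×-dec g (primeCount q) ≟ _) {xs = range N} p∈ =
      proj₂ (∈-range⁻ p∈range) , pr , g≡b

    levelSize-zero-≤ : levelSize 0 ≤ 1
    levelSize-zero-≤ = length-≤-⊆ {ys = 1 ∷ []} (level-unique 0)
      (λ m∈ → let (1≤m , _) , gm≡0 = ∈-level⁻ m∈ in here (g≡0⇒≡1 1≤m gm≡0))

    primesAt-≤-levelSize : ∀ b → length (primesAt b) ≤ levelSize b
    primesAt-≤-levelSize b = length-≤-injection primeCount
      (filter⁺ (λ p → prime? p ×-dec g (primeCount p) ≟ b) (range-unique N))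
      (λ p∈ q∈ → primeCount-injective (proj₁ (proj₂ (∈-primesAt⁻ p∈))) (proj₁ (proj₂ (∈-primesAt⁻ q∈))))
      (λ p∈ → let p≤N , pr , g≡b = ∈-primesAt⁻ p∈ in
              ∈-level⁺ (primeCount-prime-pos pr) (≤-trans (primeCount-≤ _) p≤N) g≡b)

    splittingsAt : ℕ → ℕ → List ℕ
    splittingsAt a b = cartesianProductWith _*_ (primesAt b) (level (a ∸ b))

    splittings : ℕ → List ℕ
    splittings a = concat (applyUpTo (splittingsAt a) (suc a))

    level-suc-⊆ : ∀ {a m} → m ∈ level (suc a) → m ∈ splittings a
    level-suc-⊆ {a} {m} m∈ = subst (_∈ splittings a) (sym m≡p*k)
      (∈-concat⁺′ {xss = applyUpTo (splittingsAt a) (suc a)}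
                  (∈-cartesianProductWith⁺ _*_ p∈ k∈) (∈-applyUpTo⁺ (splittingsAt a) b<1+a))
      where
      1≤m : 1 ≤ m
      1≤m = proj₁ (proj₁ (∈-level⁻ m∈))
      m≤N : m ≤ N
      m≤N = proj₂ (proj₁ (∈-level⁻ m∈))
      gm≡1+a : g m ≡ suc a
      gm≡1+a = proj₂ (∈-level⁻ m∈)
      s : PrimeSplit m
      s = prime-split (g≢0⇒≥2 1≤m (λ gm≡0 → contradiction (trans (sym gm≡0) gm≡1+a) λ ()))
      open PrimeSplit s
      b : ℕ
      b = g (primeCount p)
      b+gk≡a : b + g k ≡ a
      b+gk≡a = suc-injective (trans (sym (g-split s)) gm≡1+a)
      b<1+a : b < suc a
      b<1+a = s≤s (≤-trans (m≤m+n b (g k)) (≤-reflexive b+gk≡a))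
      p∈ : p ∈ primesAt b
      p∈ = ∈-primesAt⁺ (≤-trans p≤m m≤N) prime
      k∈ : k ∈ level (a ∸ b)
      k∈ = ∈-level⁺ 1≤k (≤-trans k≤m m≤N) (sym (trans (cong (_∸ b) (sym b+gk≡a)) (m+n∸m≡n b (g k))))

    levelSize-suc-≤ : ∀ a → levelSize (suc a) ≤ (levelSize ⋆ levelSize) a
    levelSize-suc-≤ a = begin
      levelSize (suc a)
        ≤⟨ length-≤-⊆ (level-unique (suc a)) level-suc-⊆ ⟩
      length (splittings a)
        ≡⟨ length-concat-applyUpTo (suc a) (splittingsAt a) ⟩
      ∑[ b < suc a ] length (splittingsAt a b)
        ≡⟨ ∑-cong (suc a) (λ b → length-cartesianProductWith _*_ (primesAt b) (level (a ∸ b))) ⟩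
      ∑[ b < suc a ] (length (primesAt b) * levelSize (a ∸ b))
        ≤⟨ ∑-mono-≤ (suc a) (λ b → *-monoˡ-≤ (levelSize (a ∸ b)) (primesAt-≤-levelSize b)) ⟩
      (levelSize ⋆ levelSize) a ∎
      where open ≤-Reasoning

    below-≤-catalanSum : ∀ k → below g N k ≤ catalanSum k
    below-≤-catalanSum zero    = ≤-reflexive (length-filter-<-zero g (range N))
    below-≤-catalanSum (suc k) = begin
      below g N (suc k)         ≡⟨ length-filter-<-suc g k (range N) ⟩
      below g N k + levelSize k ≤⟨ +-mono-≤ (below-≤-catalanSum k)
                                            (≤-catalan {levelSize} levelSize-zero-≤ levelSize-suc-≤ k) ⟩
      catalanSum k + catalan k  ∎
      where open ≤-Reasoning

  G⁻-≤-G : ∀ n → G⁻ n ≤ G g n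
  G⁻-≤-G n = ≤-trans (∑-mono-≤ n (λ e → ∸-monoʳ-≤ n (Levels.below-≤-catalanSum n (suc e))))
                     (layer-cake g n n)

mainTheorem3 : (g : ℕ → ℕ) → IsGIM g →
    ∀ n → 1 ≤ n → n ^ n ≤ 4 ^ G g n
mainTheorem3 g gim (suc n) _ = ≤-trans (self-power-≤ n) (^-monoʳ-≤ 4 (G⁻-≤-G gim (suc n)))
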